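{- Fix an integer $N\geq 2$ and let $f(n,c):=\inf\{M(S)\mid S\subseteq\{0,1,\dots,N-1\}^n,\ \delta(S)\geq c\}$. For $c\in(0,1]$ and $n>\lceil\log_N(8c^{ -2})\rceil$, \[ f(n,c)\geq f\big(n-\lceil\log_N(8c^{ -2})\rceil,\ 2c^2(c+4)^{ -2}\big)+1. \]
   Context: For $S\subseteq\{0,1,\dots,N-1\}^n$, $\delta(S)=|S|/N^n$. For a finite set $S\subseteq\mathbb{Z}^n$, $M(S):=M(\mathrm{Conv}(S))$, where for an integral convex polytope $P\subseteq\mathbb{R}^n$, $M(P)$ is the largest integer $m$ such that there is a unimodular affine transformation $A$ (an affine map $x\mapsto Bx+z$ with $B$ an injective integer $n\times m$ matrix and $z\in\mathbb{Z}^n$) with $A([0,1]^m)\subseteq P$.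
   Formalization: The parameter c ranges over the rationals in $(0,1]$. -}

module Defs where

open import Data.Nat as ℕ using (ℕ; zero; suc; NonZero)
open import Data.Nat.Properties using (m^n≢0)
open import Data.Fin using (Fin; toℕ)
open import Data.Vec as V using (Vec; []; _∷_)
open import Data.Vec.Relation.Unary.All as VAll using ()
open import Data.List as L using (List; [_])
open import Data.List.Relation.Unary.All as LAll using ()
open import Data.Bool using (Bool; true; false; if_then_else_)
open import Data.Integer as ℤ using (ℤ; +_)
open import Data.Rational as ℚ using (ℚ; 0ℚ; 1ℚ; positive)
open import Data.Rational.Properties using (pos⇒nonZero; pos+pos⇒pos; pos*pos⇒pos)
open import Data.Product using (Σ; _×_; _,_; proj₁; proj₂)
open import Relation.Binary.PropositionalEquality using (_≡_)

ℤtoℚ : ℤ → ℚ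
ℤtoℚ z = z ℚ./ 1

ℕtoℚ : ℕ → ℚ
ℕtoℚ k = (+ k) ℚ./ 1

zeroℤv : ∀ n → Vec ℤ n
zeroℤv n = V.replicate n (+ 0)

zeroℚv : ∀ n → Vec ℚ n
zeroℚv n = V.replicate n 0ℚ

-- An integer n×m matrix, stored as its m columns (each in ℤ^n).
Mat : ℕ → ℕ → Set
Mat n m = Vec (Vec ℤ n) m

applyℤ : ∀ {n m} → Mat n m → Vec ℤ m → Vec ℤ n
applyℤ {n} [] [] = zeroℤv n
applyℤ (col ∷ B) (x ∷ xs) = V.zipWith ℤ._+_ (V.map (x ℤ.*_) col) (applyℤ B xs)

applyℚ : ∀ {n m} → Mat n m → Vec ℚ m → Vec ℚ n
applyℚ {n} [] [] = zeroℚv n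
applyℚ (col ∷ B) (x ∷ xs) =
  V.zipWith ℚ._+_ (V.map (λ a → x ℚ.* ℤtoℚ a) col) (applyℚ B xs)

InjectiveMat : ∀ {n m} → Mat n m → Set
InjectiveMat {n} {m} B = (x y : Vec ℤ m) → applyℤ B x ≡ applyℤ B y → x ≡ y

module _ (N : ℕ) .{{_ : NonZero N}} where

  Point : ℕ → Set
  Point n = Vec (Fin N) n

  GridSubset : ℕ → Set
  GridSubset n = Point n → Bool

  allPoints : ∀ n → List (Point n)
  allPoints zero = [ [] ]
  allPoints (suc n) = L.concatMap (λ i → L.map (i ∷_) (allPoints n)) (L.allFin N)

  card : ∀ {n} → GridSubset n → ℕ
  card {n} S = L.foldr ℕ._+_ 0 (L.map (λ p → if S p then 1 else 0) (allPoints n))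

  δ : ∀ {n} → GridSubset n → ℚ
  δ {n} S = ((+ card S) ℚ./ (N ℕ.^ n)) {{m^n≢0 N n}}

  pointℚ : ∀ {n} → Point n → Vec ℚ n
  pointℚ = V.map (λ i → ℕtoℚ (toℕ i))

  combo : ∀ {n} → List (ℚ × Point n) → Vec ℚ n
  combo {n} L.[] = zeroℚv n
  combo ((w , p) L.∷ ws) = V.zipWith ℚ._+_ (V.map (w ℚ.*_) (pointℚ p)) (combo ws)

  sumWeights : ∀ {n} → List (ℚ × Point n) → ℚ
  sumWeights ws = L.foldr ℚ._+_ 0ℚ (L.map proj₁ ws)

  -- y ∈ Conv(S) (rational points of the convex hull): y is a convex
  -- combination, with rational weights, of points of S.
  InConv : ∀ {n} → GridSubset n → Vec ℚ n → Set
  InConv {n} S y =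
    Σ (List (ℚ × Point n)) λ ws →
      LAll.All (λ wp → S (proj₂ wp) ≡ true) ws ×
      LAll.All (λ wp → 0ℚ ℚ.≤ proj₁ wp) ws ×
      sumWeights ws ≡ 1ℚ ×
      combo ws ≡ y

  -- There is a unimodular affine map A(x) = Bx + z (B an injective integer
  -- n×m matrix, z ∈ ℤ^n) with A([0,1]^m) ⊆ Conv(S).
  HasCube : ∀ {n} → GridSubset n → ℕ → Set
  HasCube {n} S m =
    Σ (Mat n m) λ B → Σ (Vec ℤ n) λ z →
      InjectiveMat B ×
      ((x : Vec ℚ m) → VAll.All (λ t → (0ℚ ℚ.≤ t) × (t ℚ.≤ 1ℚ)) x →
        InConv S (V.zipWith ℚ._+_ (applyℚ B x) (V.map ℤtoℚ z)))

  IsM : ∀ {n} → GridSubset n → ℕ → Set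
  IsM S m = HasCube S m × ((m′ : ℕ) → HasCube S m′ → m′ ℕ.≤ m)

  IsF : ℕ → ℚ → ℕ → Set
  IsF n c v =
    (Σ (GridSubset n) λ S → (c ℚ.≤ δ S) × IsM S v) ×
    ((S : GridSubset n) → c ℚ.≤ δ S → (m : ℕ) → IsM S m → v ℕ.≤ m)

  -- k = ⌈log_N x⌉ (for x ≥ 1): k is the least natural number with x ≤ N^k
  IsCeilLog : ℚ → ℕ → Set
  IsCeilLog x k =
    (x ℚ.≤ ℕtoℚ (N ℕ.^ k)) × ((j : ℕ) → x ℚ.≤ ℕtoℚ (N ℕ.^ j) → k ℕ.≤ j)

eightOverSq : (c : ℚ) → 0ℚ ℚ.< c → ℚ
eightOverSq c 0<c = (ℚtoℚ8 ℚ.÷ (c ℚ.* c)) {{pos⇒nonZero (c ℚ.* c) {{pos*pos⇒pos c {{pc}} c {{pc}}}}}}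
  where
  pc = positive 0<c
  ℚtoℚ8 = ℕtoℚ 8

cPrime : (c : ℚ) → 0ℚ ℚ.< c → ℚ
cPrime c 0<c = ((ℕtoℚ 2 ℚ.* (c ℚ.* c)) ℚ.÷ (d ℚ.* d)) {{pos⇒nonZero (d ℚ.* d) {{pos*pos⇒pos d {{pd}} d {{pd}}}}}}
  where
  pc = positive 0<c
  d = c ℚ.+ ℕtoℚ 4
  pd = pos+pos⇒pos c {{pc}} (ℕtoℚ 4)

-- Write c = p/q, n = k + r, K = N^k ≥ 8/c², and for S ⊆ [N]^n of density at least c let S_x ⊆ [N]^r be
-- the fibre of S over x ∈ [N]^k.  Double counting gives Σ_{x,y} |S_x ∩ S_y| = Σ_z deg(z)² ≥ |S|²/N^r by
-- Cauchy–Schwarz, while the diagonal contributes at most K N^r; if every pair x ≠ y had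
-- |S_x ∩ S_y| < c′ N^r with c′ = 2c²/(c+4)², these bounds would contradict K ≥ 8/c².  So some x ≠ y has
-- δ(S_x ∩ S_y) ≥ c′.  A unit cube A([0,1]^m) in Conv(S_x ∩ S_y) extends to the cube
-- (t, u) ↦ ((1−t) x + t y, A u) in Conv(S), still injective because y − x ≠ 0, so
-- M(S) ≥ M(S_x ∩ S_y) + 1 ≥ f(r, c′) + 1.  That M(S_x ∩ S_y) exists is only shown classically, which is
-- harmless since the conclusion is a decidable inequality.
module Submission where

open import Defs
open import Data.Nat using (ℕ; suc; _∸_; _≤_; _<_; NonZero)
open import Data.Rational using (ℚ; 0ℚ; 1ℚ) renaming (_≤_ to _≤ℚ_; _<_ to _<ℚ_)
open import Data.Nat.Properties using (m+[n∸m]≡n; <⇒≤)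
open import Relation.Binary.PropositionalEquality using (subst; sym)
open import Data.Product using (Σ; _×_; _,_; proj₁)

module FiniteSums where

  open import Data.Nat
  open import Data.Nat.Properties
  open import Data.Bool using (Bool; true; false; if_then_else_)
  open import Data.List as L using (List; []; _∷_; _++_)
  open import Data.List.Relation.Unary.All using (All; []; _∷_)
  open import Data.Sum using (inj₁; inj₂)
  open import Relation.Binary.PropositionalEquality
  open import Function using (_∘_)
  open import Data.Nat.Solver using (module +-*-Solver)
  open +-*-Solver

  𝟙 : Bool → ℕ
  𝟙 b = if b then 1 else 0

  𝟙≤1 : ∀ b → 𝟙 b ≤ 1
  𝟙≤1 true = ≤-refl
  𝟙≤1 false = z≤n

  sumOver : {A : Set} → List A → (A → ℕ) → ℕ
  sumOver xs f = L.foldr _+_ 0 (L.map f xs)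

  module _ {A : Set} where

    sumOver-cong : (xs : List A) {f g : A → ℕ} → (∀ x → f x ≡ g x) → sumOver xs f ≡ sumOver xs g
    sumOver-cong [] eq = refl
    sumOver-cong (x ∷ xs) eq = cong₂ _+_ (eq x) (sumOver-cong xs eq)

    sumOver-mono : (xs : List A) {f g : A → ℕ} → (∀ x → f x ≤ g x) → sumOver xs f ≤ sumOver xs g
    sumOver-mono [] le = ≤-refl
    sumOver-mono (x ∷ xs) le = +-mono-≤ (le x) (sumOver-mono xs le)

    sumOver-mono-All : (xs : List A) {f g : A → ℕ} → All (λ x → f x ≤ g x) xs → sumOver xs f ≤ sumOver xs g
    sumOver-mono-All [] [] = ≤-refl
    sumOver-mono-All (x ∷ xs) (le ∷ les) = +-mono-≤ le (sumOver-mono-All xs les)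

    sumOver-++ : (xs ys : List A) (f : A → ℕ) → sumOver (xs ++ ys) f ≡ sumOver xs f + sumOver ys f
    sumOver-++ [] ys f = refl
    sumOver-++ (x ∷ xs) ys f rewrite sumOver-++ xs ys f = sym (+-assoc (f x) _ _)

    sumOver-+ : (xs : List A) (f g : A → ℕ) → sumOver xs (λ x → f x + g x) ≡ sumOver xs f + sumOver xs g
    sumOver-+ [] f g = refl
    sumOver-+ (x ∷ xs) f g rewrite sumOver-+ xs f g =
      solve 4 (λ a b c d → a :+ b :+ (c :+ d) := a :+ c :+ (b :+ d)) refl (f x) (g x) (sumOver xs f) (sumOver xs g)

    sumOver-*ˡ : (xs : List A) (c : ℕ) (f : A → ℕ) → sumOver xs (λ x → c * f x) ≡ c * sumOver xs f
    sumOver-*ˡ [] c f = sym (*-zeroʳ c)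
    sumOver-*ˡ (x ∷ xs) c f rewrite sumOver-*ˡ xs c f = sym (*-distribˡ-+ c (f x) _)

    sumOver-*ʳ : (xs : List A) (c : ℕ) (f : A → ℕ) → sumOver xs (λ x → f x * c) ≡ sumOver xs f * c
    sumOver-*ʳ xs c f = trans (sumOver-cong xs (λ x → *-comm (f x) c)) (trans (sumOver-*ˡ xs c f) (*-comm c _))

    0<sumOver-𝟙⇒∃ : (xs : List A) (T : A → Bool) → 0 < sumOver xs (λ x → 𝟙 (T x)) → Σ A λ x → T x ≡ true
    0<sumOver-𝟙⇒∃ (x ∷ xs) T 0<sum with T x in Tx
    ... | true = x , Tx
    ... | false = 0<sumOver-𝟙⇒∃ xs T 0<sum

    sumOver-const : (xs : List A) (c : ℕ) → sumOver xs (λ _ → c) ≡ L.length xs * c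
    sumOver-const [] c = refl
    sumOver-const (x ∷ xs) c = cong (c +_) (sumOver-const xs c)

  module _ {A B : Set} where

    sumOver-map : (g : A → B) (xs : List A) (f : B → ℕ) → sumOver (L.map g xs) f ≡ sumOver xs (f ∘ g)
    sumOver-map g [] f = refl
    sumOver-map g (x ∷ xs) f = cong (f (g x) +_) (sumOver-map g xs f)

    sumOver-concatMap : (g : A → List B) (xs : List A) (f : B → ℕ) →
      sumOver (L.concatMap g xs) f ≡ sumOver xs (λ x → sumOver (g x) f)
    sumOver-concatMap g [] f = refl
    sumOver-concatMap g (x ∷ xs) f =
      trans (sumOver-++ (g x) (L.concatMap g xs) f) (cong (sumOver (g x) f +_) (sumOver-concatMap g xs f))

    sumOver-swap : (xs : List A) (ys : List B) (f : A → B → ℕ) →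
      sumOver xs (λ x → sumOver ys (f x)) ≡ sumOver ys (λ y → sumOver xs (λ x → f x y))
    sumOver-swap [] ys f = sym (trans (sumOver-const ys 0) (*-zeroʳ (L.length ys)))
    sumOver-swap (x ∷ xs) ys f rewrite sumOver-swap xs ys f =
      sym (sumOver-+ ys (f x) (λ y → sumOver xs (λ x → f x y)))

  2a[a+d]≤a²+[a+d]² : ∀ a d → 2 * (a * (a + d)) ≤ a * a + (a + d) * (a + d)
  2a[a+d]≤a²+[a+d]² a d = subst (2 * (a * (a + d)) ≤_)
    (solve 2 (λ a d → con 2 :* (a :* (a :+ d)) :+ d :* d := a :* a :+ (a :+ d) :* (a :+ d)) refl a d)
    (m≤m+n _ (d * d))

  2ab≤a²+b² : ∀ a b → 2 * (a * b) ≤ a * a + b * b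
  2ab≤a²+b² a b with ≤-total a b
  ... | inj₁ a≤b with m≤n⇒∃[o]m+o≡n a≤b
  ...   | d , refl = 2a[a+d]≤a²+[a+d]² a d
  2ab≤a²+b² a b | inj₂ b≤a with m≤n⇒∃[o]m+o≡n b≤a
  ...   | d , refl = subst₂ _≤_ (cong (2 *_) (*-comm b (b + d))) (+-comm (b * b) _) (2a[a+d]≤a²+[a+d]² b d)

  module _ {A : Set} where

    -- Sum the pointwise inequality 2 f(x) f(y) ≤ f(x)² + f(y)² over all pairs.
    cauchy-schwarz : (xs : List A) (f : A → ℕ) →
      sumOver xs f * sumOver xs f ≤ L.length xs * sumOver xs (λ x → f x * f x)
    cauchy-schwarz xs f = *-cancelˡ-≤ 2 (subst₂ _≤_ pairs-lhs pairs-rhs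
      (sumOver-mono xs (λ x → sumOver-mono xs (λ y → 2ab≤a²+b² (f x) (f y)))))
      where
      n = L.length xs
      s = sumOver xs f
      Q = sumOver xs (λ x → f x * f x)
      open ≡-Reasoning
      pairs-lhs : sumOver xs (λ x → sumOver xs (λ y → 2 * (f x * f y))) ≡ 2 * (s * s)
      pairs-lhs = begin
        sumOver xs (λ x → sumOver xs (λ y → 2 * (f x * f y)))
          ≡⟨ sumOver-cong xs (λ x → trans (sumOver-*ˡ xs 2 _) (cong (2 *_) (sumOver-*ˡ xs (f x) f))) ⟩
        sumOver xs (λ x → 2 * (f x * s))  ≡⟨ sumOver-*ˡ xs 2 _ ⟩
        2 * sumOver xs (λ x → f x * s)    ≡⟨ cong (2 *_) (sumOver-*ʳ xs s f) ⟩
        2 * (s * s)                        ∎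
      pairs-rhs : sumOver xs (λ x → sumOver xs (λ y → f x * f x + f y * f y)) ≡ 2 * (n * Q)
      pairs-rhs = begin
        sumOver xs (λ x → sumOver xs (λ y → f x * f x + f y * f y))
          ≡⟨ sumOver-cong xs (λ x → sumOver-+ xs _ _) ⟩
        sumOver xs (λ x → sumOver xs (λ _ → f x * f x) + Q)
          ≡⟨ sumOver-+ xs _ _ ⟩
        sumOver xs (λ x → sumOver xs (λ _ → f x * f x)) + sumOver xs (λ _ → Q)
          ≡⟨ cong₂ _+_ (sumOver-cong xs (λ x → sumOver-const xs (f x * f x))) (sumOver-const xs Q) ⟩
        sumOver xs (λ x → n * (f x * f x)) + n * Q
          ≡⟨ cong (_+ n * Q) (sumOver-*ˡ xs n _) ⟩
        n * Q + n * Q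
          ≡⟨ solve 2 (λ n Q → n :* Q :+ n :* Q := con 2 :* (n :* Q)) refl n Q ⟩
        2 * (n * Q) ∎

module Arithmetic where

  open import Data.Nat
  open import Data.Nat.Properties
  open import Relation.Binary.PropositionalEquality
  open import Data.Nat.Solver using (module +-*-Solver)
  open +-*-Solver

  -- With X = K p², the counting bounds collapse, after cancelling K m², to E X ≤ q² E + 2 q² X.
  counting-inequality : ∀ p q s m K D E → .{{NonZero K}} → .{{NonZero m}} →
    p * K * m ≤ q * s → s * s ≤ m * D → E * D ≤ K * E * m + K * K * (2 * (p * p) * m) →
    E * (K * (p * p)) ≤ q * q * E + 2 * (q * q) * (K * (p * p))
  counting-inequality p q s m K D E pKm≤qs s²≤mD ED≤ =
    *-cancelˡ-≤ (K * m * m) {{m*n≢0 (K * m) m {{m*n≢0 K m}}}} (begin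
      K * m * m * (E * (K * (p * p)))
        ≡⟨ solve 4 (λ E p K m → K :* m :* m :* (E :* (K :* (p :* p))) := E :* ((p :* K :* m) :* (p :* K :* m))) refl E p K m ⟩
      E * ((p * K * m) * (p * K * m))  ≤⟨ *-monoʳ-≤ E (*-mono-≤ pKm≤qs pKm≤qs) ⟩
      E * ((q * s) * (q * s))
        ≡⟨ solve 3 (λ E q s → E :* ((q :* s) :* (q :* s)) := q :* q :* (E :* (s :* s))) refl E q s ⟩
      q * q * (E * (s * s))            ≤⟨ *-monoʳ-≤ (q * q) (*-monoʳ-≤ E s²≤mD) ⟩
      q * q * (E * (m * D))
        ≡⟨ solve 4 (λ q E m D → q :* q :* (E :* (m :* D)) := q :* q :* m :* (E :* D)) refl q E m D ⟩
      q * q * m * (E * D)              ≤⟨ *-monoʳ-≤ (q * q * m) ED≤ ⟩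
      q * q * m * (K * E * m + K * K * (2 * (p * p) * m))
        ≡⟨ solve 5 (λ q m K E p → q :* q :* m :* (K :* E :* m :+ K :* K :* (con 2 :* (p :* p) :* m))
                   := K :* m :* m :* (q :* q :* E :+ con 2 :* (q :* q) :* (K :* (p :* p)))) refl q m K E p ⟩
      K * m * m * (q * q * E + 2 * (q * q) * (K * (p * p))) ∎)
    where open ≤-Reasoning

  quadratic-gap : ∀ a E X → .{{NonZero a}} → 16 * a ≤ E → 8 * a ≤ X → a * E + 2 * a * X < E * X
  quadratic-gap a E X 16a≤E 8a≤X with m≤n⇒∃[o]m+o≡n 16a≤E | m≤n⇒∃[o]m+o≡n 8a≤X
  ... | e , refl | x , refl = begin-strict
    a * (16 * a + e) + 2 * a * (8 * a + x)
      <⟨ m<m+n _ (>-nonZero⁻¹ (96 * (a * a)) {{m*n≢0 96 (a * a)}}) ⟩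
    a * (16 * a + e) + 2 * a * (8 * a + x) + 96 * (a * a)
      ≤⟨ m≤m+n _ (14 * a * x + 7 * a * e + e * x) ⟩
    a * (16 * a + e) + 2 * a * (8 * a + x) + 96 * (a * a) + (14 * a * x + 7 * a * e + e * x)
      ≡⟨ solve 3 (λ a e x → a :* (con 16 :* a :+ e) :+ con 2 :* a :* (con 8 :* a :+ x) :+ con 96 :* (a :* a)
                            :+ (con 14 :* a :* x :+ con 7 :* a :* e :+ e :* x)
                         := (con 16 :* a :+ e) :* (con 8 :* a :+ x)) refl a e x ⟩
    (16 * a + e) * (8 * a + x) ∎
    where
    open ≤-Reasoning
    instance
      _ : NonZero (a * a)
      _ = m*n≢0 a a

module GridSums where

  open import Data.Nat
  open import Data.Nat.Properties
  open import Data.Fin using (Fin; zero; suc)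
  open import Data.Vec as V using (Vec; []; _∷_)
  import Data.List as L
  import Data.List.Properties as LP
  open import Relation.Binary.PropositionalEquality
  open import Function using (id; _∘_)
  open FiniteSums

  kronecker : ∀ {n} → Fin n → Fin n → ℕ
  kronecker zero    zero    = 1
  kronecker zero    (suc j) = 0
  kronecker (suc i) zero    = 0
  kronecker (suc i) (suc j) = kronecker i j

  kronecker-refl : ∀ {n} (i : Fin n) → kronecker i i ≡ 1
  kronecker-refl zero = refl
  kronecker-refl (suc i) = kronecker-refl i

  kroneckerᵛ : ∀ {n k} → Vec (Fin n) k → Vec (Fin n) k → ℕ
  kroneckerᵛ [] [] = 1
  kroneckerᵛ (i ∷ x) (j ∷ y) = kronecker i j * kroneckerᵛ x y

  kroneckerᵛ-refl : ∀ {n k} (x : Vec (Fin n) k) → kroneckerᵛ x x ≡ 1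
  kroneckerᵛ-refl [] = refl
  kroneckerᵛ-refl (i ∷ x) rewrite kronecker-refl i | kroneckerᵛ-refl x = refl

  sumOver-allFin-suc : ∀ n (f : Fin (suc n) → ℕ) → sumOver (L.allFin (suc n)) f ≡ f zero + sumOver (L.allFin n) (f ∘ suc)
  sumOver-allFin-suc n f = cong (λ xs → f zero + L.foldr _+_ 0 xs)
    (trans (LP.map-tabulate suc f) (sym (LP.map-tabulate id (f ∘ suc))))

  sumOver-allFin-kronecker : ∀ n (i : Fin n) → sumOver (L.allFin n) (kronecker i) ≡ 1
  sumOver-allFin-kronecker (suc n) zero = trans (sumOver-allFin-suc n (kronecker zero))
    (cong suc (trans (sumOver-const (L.allFin n) 0) (*-zeroʳ (L.length (L.allFin n)))))
  sumOver-allFin-kronecker (suc n) (suc i) = trans (sumOver-allFin-suc n (kronecker (suc i)))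
    (sumOver-allFin-kronecker n i)

  module _ (N : ℕ) .{{_ : NonZero N}} where

    sumOver-allPoints-suc : ∀ k (f : Point N (suc k) → ℕ) →
      sumOver (allPoints N (suc k)) f ≡ sumOver (L.allFin N) (λ i → sumOver (allPoints N k) (f ∘ (i ∷_)))
    sumOver-allPoints-suc k f = trans (sumOver-concatMap (λ i → L.map (i ∷_) (allPoints N k)) (L.allFin N) f)
      (sumOver-cong (L.allFin N) (λ i → sumOver-map (i ∷_) (allPoints N k) f))

    sumOver-allPoints-++ : ∀ k r (f : Point N (k + r) → ℕ) →
      sumOver (allPoints N (k + r)) f ≡ sumOver (allPoints N k) (λ x → sumOver (allPoints N r) (f ∘ (x V.++_)))
    sumOver-allPoints-++ zero r f = sym (+-identityʳ _)
    sumOver-allPoints-++ (suc k) r f = begin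
      sumOver (allPoints N (suc k + r)) f
        ≡⟨ sumOver-allPoints-suc (k + r) f ⟩
      sumOver (L.allFin N) (λ i → sumOver (allPoints N (k + r)) (f ∘ (i ∷_)))
        ≡⟨ sumOver-cong (L.allFin N) (λ i → sumOver-allPoints-++ k r (f ∘ (i ∷_))) ⟩
      sumOver (L.allFin N) (λ i → sumOver (allPoints N k) (λ x → sumOver (allPoints N r) (f ∘ ((i ∷ x) V.++_))))
        ≡⟨ sym (sumOver-allPoints-suc k _) ⟩
      sumOver (allPoints N (suc k)) (λ x → sumOver (allPoints N r) (f ∘ (x V.++_))) ∎
      where open ≡-Reasoning

    length-allPoints : ∀ k → L.length (allPoints N k) ≡ N ^ k
    length-allPoints k = trans (sym (*-identityʳ _)) (trans (sym (sumOver-const (allPoints N k) 1)) (count k))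
      where
      count : ∀ k → sumOver (allPoints N k) (λ _ → 1) ≡ N ^ k
      count zero = refl
      count (suc k) = begin
        sumOver (allPoints N (suc k)) (λ _ → 1)
          ≡⟨ sumOver-allPoints-suc k _ ⟩
        sumOver (L.allFin N) (λ _ → sumOver (allPoints N k) (λ _ → 1))
          ≡⟨ trans (sumOver-const (L.allFin N) _) (cong₂ _*_ (LP.length-tabulate {n = N} id) (count k)) ⟩
        N * N ^ k ∎
        where open ≡-Reasoning

    sumOver-allPoints-kronecker : ∀ k (x : Point N k) → sumOver (allPoints N k) (kroneckerᵛ x) ≡ 1
    sumOver-allPoints-kronecker zero [] = refl
    sumOver-allPoints-kronecker (suc k) (i ∷ x) = begin
      sumOver (allPoints N (suc k)) (kroneckerᵛ (i ∷ x))
        ≡⟨ sumOver-allPoints-suc k _ ⟩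
      sumOver (L.allFin N) (λ j → sumOver (allPoints N k) (λ y → kronecker i j * kroneckerᵛ x y))
        ≡⟨ sumOver-cong (L.allFin N) (λ j → trans (sumOver-*ˡ (allPoints N k) (kronecker i j) _)
             (trans (cong (kronecker i j *_) (sumOver-allPoints-kronecker k x)) (*-identityʳ _))) ⟩
      sumOver (L.allFin N) (kronecker i)
        ≡⟨ sumOver-allFin-kronecker N i ⟩
      1 ∎
      where open ≡-Reasoning

module Fibres (N : ℕ) .{{_ : NonZero N}} where

  open import Data.Nat
  open import Data.Nat.Properties
  open import Data.Bool using (true; false; _∧_)
  import Data.Fin.Properties as FinP
  open import Data.Vec using (_++_)
  import Data.Vec.Properties as VecP
  open import Data.List.Relation.Unary.Any using (Any; any?; satisfied)
  open import Data.List.Relation.Unary.All as All using (All)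
  open import Data.List.Relation.Unary.All.Properties using (¬Any⇒All¬)
  open import Data.Product using (map₂)
  open import Data.Empty using (⊥-elim)
  open import Function using (_∘_)
  open import Relation.Nullary using (¬_; Dec; yes; no)
  open import Relation.Nullary.Decidable using (¬?; _×-dec_)
  open import Relation.Binary.PropositionalEquality
  open import Data.Nat.Solver using (module +-*-Solver)
  open +-*-Solver
  open FiniteSums
  open GridSums
  open Arithmetic

  _∩_ : ∀ {n} → GridSubset N n → GridSubset N n → GridSubset N n
  (A ∩ B) z = A z ∧ B z

  fibre : ∀ {k r} → GridSubset N (k + r) → Point N k → GridSubset N r
  fibre S x z = S (x ++ z)

  card-∩ : ∀ {n} (A B : GridSubset N n) → card N (A ∩ B) ≡ sumOver (allPoints N n) (λ z → 𝟙 (A z) * 𝟙 (B z))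
  card-∩ A B = sumOver-cong (allPoints N _) (λ z → 𝟙-∧ (A z) (B z))
    where
    𝟙-∧ : ∀ a b → 𝟙 (a ∧ b) ≡ 𝟙 a * 𝟙 b
    𝟙-∧ true b = sym (+-identityʳ (𝟙 b))
    𝟙-∧ false b = refl

  module FibreCounting (k r : ℕ) (S : GridSubset N (k + r)) where

    K : ℕ
    K = N ^ k

    m : ℕ
    m = N ^ r

    fibreOverlap : Point N k → Point N k → ℕ
    fibreOverlap x y = card N (fibre S x ∩ fibre S y)

    degree : Point N r → ℕ
    degree z = sumOver (allPoints N k) (λ x → 𝟙 (fibre S x z))

    totalOverlap : ℕ
    totalOverlap = sumOver (allPoints N k) (λ x → sumOver (allPoints N k) (fibreOverlap x))

    card≡sumOver-degree : card N S ≡ sumOver (allPoints N r) degree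
    card≡sumOver-degree = trans (sumOver-allPoints-++ N k r (λ v → 𝟙 (S v)))
      (sumOver-swap (allPoints N k) (allPoints N r) (λ x z → 𝟙 (fibre S x z)))

    totalOverlap≡sumOver-degree² : totalOverlap ≡ sumOver (allPoints N r) (λ z → degree z * degree z)
    totalOverlap≡sumOver-degree² = begin
      totalOverlap
        ≡⟨ sumOver-cong (allPoints N k) (λ x → sumOver-cong (allPoints N k) (λ y → card-∩ (fibre S x) (fibre S y))) ⟩
      sumOver (allPoints N k) (λ x → sumOver (allPoints N k) (λ y → sumOver (allPoints N r) (λ z → a x z * a y z)))
        ≡⟨ sumOver-cong (allPoints N k) (λ x → sumOver-swap (allPoints N k) (allPoints N r) _) ⟩
      sumOver (allPoints N k) (λ x → sumOver (allPoints N r) (λ z → sumOver (allPoints N k) (λ y → a x z * a y z)))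
        ≡⟨ sumOver-swap (allPoints N k) (allPoints N r) _ ⟩
      sumOver (allPoints N r) (λ z → sumOver (allPoints N k) (λ x → sumOver (allPoints N k) (λ y → a x z * a y z)))
        ≡⟨ sumOver-cong (allPoints N r) (λ z →
             trans (sumOver-cong (allPoints N k) (λ x → sumOver-*ˡ (allPoints N k) (a x z) (λ y → a y z)))
                   (sumOver-*ʳ (allPoints N k) (degree z) (λ x → a x z))) ⟩
      sumOver (allPoints N r) (λ z → degree z * degree z) ∎
      where
      open ≡-Reasoning
      a : Point N k → Point N r → ℕ
      a x z = 𝟙 (fibre S x z)

    card²≤m*totalOverlap : card N S * card N S ≤ m * totalOverlap
    card²≤m*totalOverlap = subst₂ _≤_
      (cong₂ _*_ (sym card≡sumOver-degree) (sym card≡sumOver-degree))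
      (cong₂ _*_ (length-allPoints N r) (sym totalOverlap≡sumOver-degree²))
      (cauchy-schwarz (allPoints N r) degree)

    fibreOverlap≤m : ∀ x y → fibreOverlap x y ≤ m
    fibreOverlap≤m x y = begin
      fibreOverlap x y
        ≡⟨ card-∩ (fibre S x) (fibre S y) ⟩
      sumOver (allPoints N r) (λ z → 𝟙 (fibre S x z) * 𝟙 (fibre S y z))
        ≤⟨ sumOver-mono (allPoints N r) (λ z → *-mono-≤ (𝟙≤1 (fibre S x z)) (𝟙≤1 (fibre S y z))) ⟩
      sumOver (allPoints N r) (λ _ → 1)
        ≡⟨ trans (sumOver-const (allPoints N r) 1) (trans (*-identityʳ _) (length-allPoints N r)) ⟩
      m ∎
      where open ≤-Reasoning

    LargeOverlap : ℕ → ℕ → Point N k → Point N k → Set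
    LargeOverlap A E x y = ¬ x ≡ y × A ≤ E * fibreOverlap x y

    largeOverlap? : ∀ A E x y → Dec (LargeOverlap A E x y)
    largeOverlap? A E x y = ¬? (VecP.≡-dec FinP._≟_ x y) ×-dec (A ≤? E * fibreOverlap x y)

    -- Off the diagonal the weighted overlap is below A; on it, it is at most E m.
    totalOverlap-bound : ∀ A E → All (λ x → All (λ y → ¬ LargeOverlap A E x y) (allPoints N k)) (allPoints N k) →
      E * totalOverlap ≤ K * E * m + K * K * A
    totalOverlap-bound A E small = begin
      E * totalOverlap
        ≡⟨ sym (sumOver-*ˡ (allPoints N k) E _) ⟩
      sumOver (allPoints N k) (λ x → E * sumOver (allPoints N k) (fibreOverlap x))
        ≡⟨ sumOver-cong (allPoints N k) (λ x → sym (sumOver-*ˡ (allPoints N k) E _)) ⟩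
      sumOver (allPoints N k) (λ x → sumOver (allPoints N k) (λ y → E * fibreOverlap x y))
        ≤⟨ sumOver-mono-All (allPoints N k) (All.map (λ {x} → sumOver-mono-All (allPoints N k) ∘ All.map (pointwise x)) small) ⟩
      sumOver (allPoints N k) (λ x → sumOver (allPoints N k) (λ y → E * m * kroneckerᵛ x y + A))
        ≡⟨ sumOver-cong (allPoints N k) row ⟩
      sumOver (allPoints N k) (λ _ → E * m + K * A)
        ≡⟨ trans (sumOver-const (allPoints N k) _) (cong (_* (E * m + K * A)) (length-allPoints N k)) ⟩
      K * (E * m + K * A)
        ≡⟨ solve 4 (λ K E m A → K :* (E :* m :+ K :* A) := K :* E :* m :+ K :* K :* A) refl K E m A ⟩
      K * E * m + K * K * A ∎
      where
      open ≤-Reasoning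
      pointwise : ∀ x {y} → ¬ LargeOverlap A E x y → E * fibreOverlap x y ≤ E * m * kroneckerᵛ x y + A
      pointwise x {y} notLarge with VecP.≡-dec FinP._≟_ x y
      ... | yes refl = ≤-trans (*-monoʳ-≤ E (fibreOverlap≤m x x))
            (subst (λ t → E * m ≤ E * m * t + A) (sym (kroneckerᵛ-refl x))
              (subst (_≤ E * m * 1 + A) (*-identityʳ (E * m)) (m≤m+n _ A)))
      ... | no x≢y = ≤-trans (<⇒≤ (≰⇒> (λ le → notLarge (x≢y , le)))) (m≤n+m A _)
      row : ∀ x → sumOver (allPoints N k) (λ y → E * m * kroneckerᵛ x y + A) ≡ E * m + K * A
      row x = begin-equality
        sumOver (allPoints N k) (λ y → E * m * kroneckerᵛ x y + A)
          ≡⟨ sumOver-+ (allPoints N k) _ _ ⟩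
        sumOver (allPoints N k) (λ y → E * m * kroneckerᵛ x y) + sumOver (allPoints N k) (λ _ → A)
          ≡⟨ cong₂ _+_ (trans (sumOver-*ˡ (allPoints N k) (E * m) (kroneckerᵛ x))
                              (trans (cong (E * m *_) (sumOver-allPoints-kronecker N k x)) (*-identityʳ _)))
                       (trans (sumOver-const (allPoints N k) A) (cong (_* A) (length-allPoints N k))) ⟩
        E * m + K * A ∎

    ∃-largeOverlap : ∀ p q → .{{NonZero q}} → 8 * (q * q) ≤ K * (p * p) → p * K * m ≤ q * card N S →
      Σ (Point N k) λ x → Σ (Point N k) λ y → LargeOverlap (2 * (p * p) * m) ((p + 4 * q) * (p + 4 * q)) x y
    ∃-largeOverlap p q 8q²≤Kp² pKm≤qs = search (any? (λ x → any? (largeOverlap? A E x) (allPoints N k)) (allPoints N k))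
      where
      A = 2 * (p * p) * m
      E = (p + 4 * q) * (p + 4 * q)
      instance
        _ : NonZero (q * q)
        _ = m*n≢0 q q
      16q²≤E : 16 * (q * q) ≤ E
      16q²≤E = subst (_≤ E) (solve 1 (λ q → (con 4 :* q) :* (con 4 :* q) := con 16 :* (q :* q)) refl q)
        (*-mono-≤ (m≤n+m (4 * q) p) (m≤n+m (4 * q) p))
      search : Dec (Any (λ x → Any (LargeOverlap A E x) (allPoints N k)) (allPoints N k)) →
        Σ (Point N k) λ x → Σ (Point N k) λ y → LargeOverlap A E x y
      search (yes found) = map₂ satisfied (satisfied found)
      search (no none) = ⊥-elim (<⇒≱ (quadratic-gap (q * q) E (K * (p * p)) 16q²≤E 8q²≤Kp²)
        (counting-inequality p q (card N S) m K totalOverlap E {{m^n≢0 N k}} {{m^n≢0 N r}}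
          pKm≤qs card²≤m*totalOverlap
          (totalOverlap-bound A E (All.map (¬Any⇒All¬ (allPoints N k)) (¬Any⇒All¬ (allPoints N k) none)))))

module RationalEmbedding where

  open import Data.Nat as ℕ using (ℕ; suc; NonZero)
  import Data.Nat.Properties as ℕP
  open import Data.Integer as ℤ using (ℤ; +_; -[1+_])
  import Data.Integer.Properties as ℤP
  open import Data.Rational as ℚ using (ℚ; mkℚ; 0ℚ; toℚᵘ)
  open import Data.Rational.Properties
  open import Data.Rational.Unnormalised as ℚᵘ using (mkℚᵘ; *≡*; *≤*)
  import Data.Rational.Unnormalised.Properties as ℚᵘP
  open import Data.Empty using (⊥-elim)
  open import Relation.Binary.PropositionalEquality
  open import Data.Integer.Solver using (module +-*-Solver)
  open +-*-Solver

  toℚᵘ-ℤtoℚ : ∀ i → toℚᵘ (ℤtoℚ i) ℚᵘ.≃ mkℚᵘ i 0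
  toℚᵘ-ℤtoℚ i = toℚᵘ-fromℚᵘ (mkℚᵘ i 0)

  ℤtoℚ-+ : ∀ i j → ℤtoℚ (i ℤ.+ j) ≡ ℤtoℚ i ℚ.+ ℤtoℚ j
  ℤtoℚ-+ i j = toℚᵘ-injective (ℚᵘP.≃-trans (toℚᵘ-ℤtoℚ (i ℤ.+ j)) (ℚᵘP.≃-sym
    (ℚᵘP.≃-trans (toℚᵘ-homo-+ (ℤtoℚ i) (ℤtoℚ j)) (ℚᵘP.≃-trans (ℚᵘP.+-cong (toℚᵘ-ℤtoℚ i) (toℚᵘ-ℤtoℚ j))
      (*≡* (solve 2 (λ i j → (i :* con (+ 1) :+ j :* con (+ 1)) :* con (+ 1) := (i :+ j) :* con (+ 1)) refl i j))))))

  ℤtoℚ-* : ∀ i j → ℤtoℚ (i ℤ.* j) ≡ ℤtoℚ i ℚ.* ℤtoℚ j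
  ℤtoℚ-* i j = toℚᵘ-injective (ℚᵘP.≃-trans (toℚᵘ-ℤtoℚ (i ℤ.* j)) (ℚᵘP.≃-sym
    (ℚᵘP.≃-trans (toℚᵘ-homo-* (ℤtoℚ i) (ℤtoℚ j)) (ℚᵘP.≃-trans (ℚᵘP.*-cong (toℚᵘ-ℤtoℚ i) (toℚᵘ-ℤtoℚ j))
      (*≡* refl)))))

  ℤtoℚ-neg : ∀ i → ℤtoℚ (ℤ.- i) ≡ ℚ.- ℤtoℚ i
  ℤtoℚ-neg i = toℚᵘ-injective (ℚᵘP.≃-trans (toℚᵘ-ℤtoℚ (ℤ.- i)) (ℚᵘP.≃-sym
    (ℚᵘP.≃-trans (toℚᵘ-homo‿- (ℤtoℚ i)) (ℚᵘP.-‿cong (toℚᵘ-ℤtoℚ i)))))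

  ℤtoℚ-mono-≤ : ∀ {i j} → i ℤ.≤ j → ℤtoℚ i ℚ.≤ ℤtoℚ j
  ℤtoℚ-mono-≤ {i} {j} i≤j = toℚᵘ-cancel-≤ (ℚᵘP.≤-respʳ-≃ (ℚᵘP.≃-sym (toℚᵘ-ℤtoℚ j))
    (ℚᵘP.≤-respˡ-≃ (ℚᵘP.≃-sym (toℚᵘ-ℤtoℚ i)) (*≤* (ℤP.*-monoʳ-≤-nonNeg (+ 1) i≤j))))

  ℤtoℚ-cancel-≤ : ∀ {i j} → ℤtoℚ i ℚ.≤ ℤtoℚ j → i ℤ.≤ j
  ℤtoℚ-cancel-≤ {i} {j} le with ℚᵘP.≤-respʳ-≃ (toℚᵘ-ℤtoℚ j) (ℚᵘP.≤-respˡ-≃ (toℚᵘ-ℤtoℚ i) (toℚᵘ-mono-≤ le))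
  ... | *≤* i*1≤j*1 = subst₂ ℤ._≤_ (ℤP.*-identityʳ i) (ℤP.*-identityʳ j) i*1≤j*1

  ℕtoℚ-+ : ∀ a b → ℕtoℚ (a ℕ.+ b) ≡ ℕtoℚ a ℚ.+ ℕtoℚ b
  ℕtoℚ-+ a b = trans (cong ℤtoℚ (ℤP.pos-+ a b)) (ℤtoℚ-+ (+ a) (+ b))

  ℕtoℚ-* : ∀ a b → ℕtoℚ (a ℕ.* b) ≡ ℕtoℚ a ℚ.* ℕtoℚ b
  ℕtoℚ-* a b = trans (cong ℤtoℚ (ℤP.pos-* a b)) (ℤtoℚ-* (+ a) (+ b))

  ℕtoℚ-mono-≤ : ∀ {a b} → a ℕ.≤ b → ℕtoℚ a ℚ.≤ ℕtoℚ b
  ℕtoℚ-mono-≤ a≤b = ℤtoℚ-mono-≤ (ℤ.+≤+ a≤b)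

  ℕtoℚ-cancel-≤ : ∀ {a b} → ℕtoℚ a ℚ.≤ ℕtoℚ b → a ℕ.≤ b
  ℕtoℚ-cancel-≤ le = ℤP.drop‿+≤+ (ℤtoℚ-cancel-≤ le)

  ℕtoℚ-nonNeg : ∀ n → ℚ.NonNegative (ℕtoℚ n)
  ℕtoℚ-nonNeg n = normalize-nonNeg n 1

  ℕtoℚ-pos : ∀ n → .{{NonZero n}} → ℚ.Positive (ℕtoℚ n)
  ℕtoℚ-pos (suc n) = normalize-pos (suc n) 1

  /-*-cancel : ∀ i d → .{{_ : NonZero d}} → (i ℚ./ d) ℚ.* ℕtoℚ d ≡ ℤtoℚ i
  /-*-cancel i d@(suc d-1) = toℚᵘ-injective (ℚᵘP.≃-trans (toℚᵘ-homo-* (i ℚ./ d) (ℕtoℚ d))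
    (ℚᵘP.≃-trans (ℚᵘP.*-cong (toℚᵘ-fromℚᵘ (mkℚᵘ i d-1)) (toℚᵘ-ℤtoℚ (+ d)))
      (ℚᵘP.≃-trans (*≡* (solve 2 (λ i d → (i :* d) :* con (+ 1) := i :* (d :* con (+ 1))) refl i (+ d)))
        (ℚᵘP.≃-sym (toℚᵘ-ℤtoℚ i)))))

  positive-ratio : ∀ c → 0ℚ ℚ.< c → Σ ℕ λ p → Σ ℕ λ q-1 → c ℚ.* ℕtoℚ (suc q-1) ≡ ℕtoℚ p
  positive-ratio c@(mkℚ (+ p) q-1 _) _ = p , q-1 , toℚᵘ-injective
    (ℚᵘP.≃-trans (toℚᵘ-homo-* c (ℕtoℚ q)) (ℚᵘP.≃-trans (ℚᵘP.*-congˡ {mkℚᵘ (+ p) q-1} (toℚᵘ-ℤtoℚ (+ q)))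
      (ℚᵘP.≃-trans (*≡* cross) (ℚᵘP.≃-sym (toℚᵘ-ℤtoℚ (+ p))))))
    where
    q = suc q-1
    cross : (+ p ℤ.* + q) ℤ.* + 1 ≡ + p ℤ.* + (q ℕ.* 1)
    cross = trans (ℤP.*-identityʳ _) (cong (λ e → + p ℤ.* + e) (sym (ℕP.*-identityʳ q)))
  positive-ratio (mkℚ -[1+ n ] _ _) 0<c = ⊥-elim (ℤ.Positive.pos (ℚ.positive 0<c))

module DensityBounds where

  import Data.Nat as ℕ
  open import Data.Integer using (+_)
  open import Data.Rational using (_+_; _*_; _/_; 1/_; positive; Positive; NonNegative)
  import Data.Rational as ℚ
  open import Data.Rational.Properties
  open import Relation.Binary.PropositionalEquality
  open import Data.Rational.Solver using (module +-*-Solver)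
  open +-*-Solver
  open RationalEmbedding
  open ≡-Reasoning

  module _ (c : ℚ) (0<c : 0ℚ <ℚ c) (p q : ℕ) .{{_ : NonZero q}} (c*q≡p : c * ℕtoℚ q ≡ ℕtoℚ p) where

    private
      P = ℕtoℚ p
      Q = ℕtoℚ q

      instance
        _ : Positive c
        _ = positive 0<c
        _ : Positive Q
        _ = ℕtoℚ-pos q

    8/c²≤K⇒8q²≤Kp² : ∀ K → eightOverSq c 0<c ≤ℚ ℕtoℚ K → 8 ℕ.* (q ℕ.* q) ℕ.≤ K ℕ.* (p ℕ.* p)
    8/c²≤K⇒8q²≤Kp² K 8/c²≤K = ℕtoℚ-cancel-≤ (subst₂ _≤ℚ_ (sym lhs) (sym rhs)
      (*-monoʳ-≤-nonNeg (Q * Q) (subst (_≤ℚ ℕtoℚ K * (c * c)) 8/c²*c²≡8 (*-monoʳ-≤-nonNeg (c * c) 8/c²≤K))))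
      where
      instance
        _ : Positive (c * c)
        _ = pos*pos⇒pos c c
        _ : ℚ.NonZero (c * c)
        _ = pos⇒nonZero (c * c)
        _ : NonNegative (c * c)
        _ = pos⇒nonNeg (c * c)
        _ : NonNegative (Q * Q)
        _ = pos⇒nonNeg (Q * Q) {{pos*pos⇒pos Q Q}}
      8/c²*c²≡8 : eightOverSq c 0<c * (c * c) ≡ ℕtoℚ 8
      8/c²*c²≡8 = trans (*-assoc (ℕtoℚ 8) (1/ (c * c)) (c * c))
        (trans (cong (ℕtoℚ 8 *_) (*-inverseˡ (c * c))) (*-identityʳ (ℕtoℚ 8)))
      lhs : ℕtoℚ (8 ℕ.* (q ℕ.* q)) ≡ ℕtoℚ 8 * (Q * Q)
      lhs = trans (ℕtoℚ-* 8 (q ℕ.* q)) (cong (ℕtoℚ 8 *_) (ℕtoℚ-* q q))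
      rhs : ℕtoℚ (K ℕ.* (p ℕ.* p)) ≡ ℕtoℚ K * (c * c) * (Q * Q)
      rhs = begin
        ℕtoℚ (K ℕ.* (p ℕ.* p))     ≡⟨ trans (ℕtoℚ-* K (p ℕ.* p)) (cong (ℕtoℚ K *_) (ℕtoℚ-* p p)) ⟩
        ℕtoℚ K * (P * P)            ≡⟨ cong (λ e → ℕtoℚ K * (e * e)) c*q≡p ⟨
        ℕtoℚ K * ((c * Q) * (c * Q))
          ≡⟨ solve 3 (λ K c Q → K :* ((c :* Q) :* (c :* Q)) := (K :* (c :* c)) :* (Q :* Q)) refl (ℕtoℚ K) c Q ⟩
        ℕtoℚ K * (c * c) * (Q * Q)  ∎

    c≤s/d⇒pd≤sq : ∀ s d .{{_ : NonZero d}} → c ≤ℚ (+ s) / d → p ℕ.* d ℕ.≤ s ℕ.* q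
    c≤s/d⇒pd≤sq s d c≤s/d = ℕtoℚ-cancel-≤ (subst₂ _≤ℚ_ lhs rhs (*-monoʳ-≤-nonNeg (ℕtoℚ d * Q) c≤s/d))
      where
      instance
        _ : NonNegative (ℕtoℚ d * Q)
        _ = nonNeg*nonNeg⇒nonNeg (ℕtoℚ d) {{ℕtoℚ-nonNeg d}} Q {{pos⇒nonNeg Q}}
      lhs : c * (ℕtoℚ d * Q) ≡ ℕtoℚ (p ℕ.* d)
      lhs = begin
        c * (ℕtoℚ d * Q) ≡⟨ solve 3 (λ c D Q → c :* (D :* Q) := (c :* Q) :* D) refl c (ℕtoℚ d) Q ⟩
        (c * Q) * ℕtoℚ d ≡⟨ trans (cong (_* ℕtoℚ d) c*q≡p) (sym (ℕtoℚ-* p d)) ⟩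
        ℕtoℚ (p ℕ.* d)   ∎
      rhs : ((+ s) / d) * (ℕtoℚ d * Q) ≡ ℕtoℚ (s ℕ.* q)
      rhs = begin
        ((+ s) / d) * (ℕtoℚ d * Q)  ≡⟨ sym (*-assoc ((+ s) / d) (ℕtoℚ d) Q) ⟩
        ((+ s) / d) * ℕtoℚ d * Q    ≡⟨ trans (cong (_* Q) (/-*-cancel (+ s) d)) (sym (ℕtoℚ-* s q)) ⟩
        ℕtoℚ (s ℕ.* q)              ∎

    -- Both sides are multiplied by (c+4)² m q²; with c q = p the two sides become 2p²m and (p+4q)² i.
    2p²m≤Ei⇒c′≤i/m : ∀ i m .{{_ : NonZero m}} →
      2 ℕ.* (p ℕ.* p) ℕ.* m ℕ.≤ ((p ℕ.+ 4 ℕ.* q) ℕ.* (p ℕ.+ 4 ℕ.* q)) ℕ.* i → cPrime c 0<c ≤ℚ (+ i) / m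
    2p²m≤Ei⇒c′≤i/m i m 2p²m≤Ei = *-cancelʳ-≤-pos R (subst₂ _≤ℚ_ (sym lhs) (sym rhs) (ℕtoℚ-mono-≤ 2p²m≤Ei))
      where
      M = ℕtoℚ m
      d = c + ℕtoℚ 4
      R = (d * d) * (M * (Q * Q))
      instance
        _ : Positive d
        _ = pos+pos⇒pos c (ℕtoℚ 4) {{ℕtoℚ-pos 4}}
        _ : Positive (d * d)
        _ = pos*pos⇒pos d d
        _ : ℚ.NonZero (d * d)
        _ = pos⇒nonZero (d * d)
        _ : Positive R
        _ = pos*pos⇒pos (d * d) (M * (Q * Q)) {{pos*pos⇒pos M {{ℕtoℚ-pos m}} (Q * Q) {{pos*pos⇒pos Q Q}}}}
      lhs : cPrime c 0<c * R ≡ ℕtoℚ (2 ℕ.* (p ℕ.* p) ℕ.* m)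
      lhs = begin
        cPrime c 0<c * R
          ≡⟨ solve 6 (λ two c inv d M Q → ((two :* (c :* c)) :* inv) :* ((d :* d) :* (M :* (Q :* Q)))
                       := (two :* ((c :* Q) :* (c :* Q)) :* M) :* (inv :* (d :* d))) refl (ℕtoℚ 2) c (1/ (d * d)) d M Q ⟩
        (ℕtoℚ 2 * ((c * Q) * (c * Q)) * M) * (1/ (d * d) * (d * d))
          ≡⟨ cong₂ (λ e f → (ℕtoℚ 2 * (e * e) * M) * f) c*q≡p (*-inverseˡ (d * d)) ⟩
        (ℕtoℚ 2 * (P * P) * M) * 1ℚ
          ≡⟨ *-identityʳ _ ⟩
        ℕtoℚ 2 * (P * P) * M
          ≡⟨ sym (trans (ℕtoℚ-* (2 ℕ.* (p ℕ.* p)) m)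
               (cong (_* M) (trans (ℕtoℚ-* 2 (p ℕ.* p)) (cong (ℕtoℚ 2 *_) (ℕtoℚ-* p p))))) ⟩
        ℕtoℚ (2 ℕ.* (p ℕ.* p) ℕ.* m) ∎
      p+4q≡dQ : ℕtoℚ (p ℕ.+ 4 ℕ.* q) ≡ d * Q
      p+4q≡dQ = begin
        ℕtoℚ (p ℕ.+ 4 ℕ.* q)   ≡⟨ trans (ℕtoℚ-+ p (4 ℕ.* q)) (cong (λ e → P + e) (ℕtoℚ-* 4 q)) ⟩
        P + ℕtoℚ 4 * Q          ≡⟨ cong (_+ ℕtoℚ 4 * Q) c*q≡p ⟨
        c * Q + ℕtoℚ 4 * Q      ≡⟨ *-distribʳ-+ Q c (ℕtoℚ 4) ⟨
        d * Q                   ∎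
      rhs : ((+ i) / m) * R ≡ ℕtoℚ (((p ℕ.+ 4 ℕ.* q) ℕ.* (p ℕ.+ 4 ℕ.* q)) ℕ.* i)
      rhs = begin
        ((+ i) / m) * R
          ≡⟨ solve 4 (λ δ d M Q → δ :* ((d :* d) :* (M :* (Q :* Q))) := (δ :* M) :* ((d :* Q) :* (d :* Q))) refl ((+ i) / m) d M Q ⟩
        ((+ i) / m * M) * ((d * Q) * (d * Q))
          ≡⟨ cong₂ (λ e f → e * (f * f)) (/-*-cancel (+ i) m) (sym p+4q≡dQ) ⟩
        ℕtoℚ i * (ℕtoℚ (p ℕ.+ 4 ℕ.* q) * ℕtoℚ (p ℕ.+ 4 ℕ.* q))
          ≡⟨ *-comm (ℕtoℚ i) _ ⟩
        (ℕtoℚ (p ℕ.+ 4 ℕ.* q) * ℕtoℚ (p ℕ.+ 4 ℕ.* q)) * ℕtoℚ i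
          ≡⟨ sym (trans (ℕtoℚ-* ((p ℕ.+ 4 ℕ.* q) ℕ.* (p ℕ.+ 4 ℕ.* q)) i)
               (cong (_* ℕtoℚ i) (ℕtoℚ-* (p ℕ.+ 4 ℕ.* q) (p ℕ.+ 4 ℕ.* q)))) ⟩
        ℕtoℚ (((p ℕ.+ 4 ℕ.* q) ℕ.* (p ℕ.+ 4 ℕ.* q)) ℕ.* i) ∎

module BlockMatrices where

  open import Data.Nat using (zero; suc; _+_)
  open import Data.Integer as ℤ using (ℤ; +_)
  import Data.Integer.Properties as ℤP
  import Data.Rational as ℚ
  import Data.Rational.Properties as ℚP
  open import Data.Fin as Fin using (Fin; toℕ)
  import Data.Fin.Properties as FinP
  open import Data.Vec as V using (Vec; []; _∷_; _++_)
  import Data.Vec.Properties as VecP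
  open import Data.Empty using (⊥-elim)
  open import Function using (_∘_)
  open import Relation.Nullary using (¬_; yes; no)
  open import Relation.Binary.PropositionalEquality
  open import Data.Rational.Solver using (module +-*-Solver)
  open RationalEmbedding

  module _ {A B : Set} {_⊕_ : A → A → A} {f : B → A} {eB : B} {eA : A} where

    zipWith-map-padˡ : ∀ {k r} → f eB ⊕ eA ≡ eA → (col : Vec B r) (rest : Vec A r) →
      V.zipWith _⊕_ (V.map f (V.replicate k eB ++ col)) (V.replicate k eA ++ rest)
        ≡ V.replicate k eA ++ V.zipWith _⊕_ (V.map f col) rest
    zipWith-map-padˡ {zero} absorb col rest = refl
    zipWith-map-padˡ {suc k} absorb col rest = cong₂ _∷_ absorb (zipWith-map-padˡ {k} absorb col rest)

    zipWith-map-block : ∀ {k r} → (∀ a → a ⊕ eA ≡ a) → (∀ a → f eB ⊕ a ≡ a) → (d : Vec B k) (w : Vec A r) →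
      V.zipWith _⊕_ (V.map f (d ++ V.replicate r eB)) (V.replicate k eA ++ w) ≡ V.map f d ++ w
    zipWith-map-block {r = r} idʳ zeroˡ [] w = trans (cong (λ v → V.zipWith _⊕_ v w) (VecP.map-replicate f eB r))
      (VecP.zipWith-identityˡ zeroˡ w)
    zipWith-map-block idʳ zeroˡ (b ∷ d) w = cong₂ _∷_ (idʳ (f b)) (zipWith-map-block idʳ zeroˡ d w)

  replicate-++ : ∀ {A : Set} (e : A) k r → V.replicate (k + r) e ≡ V.replicate k e ++ V.replicate r e
  replicate-++ e zero r = refl
  replicate-++ e (suc k) r = cong (e ∷_) (replicate-++ e k r)

  zeroℤ-scale : ∀ t → (t ℤ.* + 0) ℤ.+ + 0 ≡ + 0
  zeroℤ-scale t = trans (ℤP.+-identityʳ _) (ℤP.*-zeroʳ t)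

  zeroℚ-scale : ∀ t → (t ℚ.* ℤtoℚ (+ 0)) ℚ.+ 0ℚ ≡ 0ℚ
  zeroℚ-scale t = trans (ℚP.+-identityʳ _) (ℚP.*-zeroʳ t)

  applyℤ-padˡ : ∀ {k r m} (B : Mat r m) (u : Vec ℤ m) →
    applyℤ (V.map (zeroℤv k ++_) B) u ≡ zeroℤv k ++ applyℤ B u
  applyℤ-padˡ {k} {r} [] [] = replicate-++ (+ 0) k r
  applyℤ-padˡ (col ∷ B) (t ∷ u) = trans (cong (V.zipWith ℤ._+_ _) (applyℤ-padˡ B u))
    (zipWith-map-padˡ (zeroℤ-scale t) col (applyℤ B u))

  applyℚ-padˡ : ∀ {k r m} (B : Mat r m) (u : Vec ℚ m) →
    applyℚ (V.map (zeroℤv k ++_) B) u ≡ zeroℚv k ++ applyℚ B u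
  applyℚ-padˡ {k} {r} [] [] = replicate-++ 0ℚ k r
  applyℚ-padˡ (col ∷ B) (t ∷ u) = trans (cong (V.zipWith ℚ._+_ _) (applyℚ-padˡ B u))
    (zipWith-map-padˡ (zeroℚ-scale t) col (applyℚ B u))

  blockMat : ∀ {k r m} → Vec ℤ k → Mat r m → Mat (k + r) (suc m)
  blockMat {k} {r} d B = (d ++ zeroℤv r) ∷ V.map (zeroℤv k ++_) B

  applyℤ-blockMat : ∀ {k r m} (d : Vec ℤ k) (B : Mat r m) t u →
    applyℤ (blockMat d B) (t ∷ u) ≡ V.map (t ℤ.*_) d ++ applyℤ B u
  applyℤ-blockMat d B t u = trans (cong (V.zipWith ℤ._+_ _) (applyℤ-padˡ B u))
    (zipWith-map-block ℤP.+-identityʳ (λ a → trans (cong (ℤ._+ a) (ℤP.*-zeroʳ t)) (ℤP.+-identityˡ a)) d (applyℤ B u))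

  applyℚ-blockMat : ∀ {k r m} (d : Vec ℤ k) (B : Mat r m) t u →
    applyℚ (blockMat d B) (t ∷ u) ≡ V.map (λ a → t ℚ.* ℤtoℚ a) d ++ applyℚ B u
  applyℚ-blockMat d B t u = trans (cong (V.zipWith ℚ._+_ _) (applyℚ-padˡ B u))
    (zipWith-map-block ℚP.+-identityʳ (λ a → trans (cong (ℚ._+ a) (ℚP.*-zeroʳ t)) (ℚP.+-identityˡ a)) d (applyℚ B u))

  blockMat-injective : ∀ {k r m} (d : Vec ℤ k) (B : Mat r m) →
    (∀ t t′ → V.map (t ℤ.*_) d ≡ V.map (t′ ℤ.*_) d → t ≡ t′) → InjectiveMat B → InjectiveMat (blockMat d B)
  blockMat-injective d B scale-injective B-injective (t ∷ u) (t′ ∷ u′) eq =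
    cong₂ _∷_ (scale-injective t t′ (VecP.++-injectiveˡ _ _ eq′)) (B-injective u u′ (VecP.++-injectiveʳ _ _ eq′))
    where
    eq′ : V.map (t ℤ.*_) d ++ applyℤ B u ≡ V.map (t′ ℤ.*_) d ++ applyℤ B u′
    eq′ = trans (sym (applyℤ-blockMat d B t u)) (trans eq (applyℤ-blockMat d B t′ u′))

  toℤᵛ : ∀ {N k} → Vec (Fin N) k → Vec ℤ k
  toℤᵛ = V.map (λ i → + toℕ i)

  difference : ∀ {N k} → Vec (Fin N) k → Vec (Fin N) k → Vec ℤ k
  difference x y = V.zipWith ℤ._-_ (toℤᵛ y) (toℤᵛ x)

  -- Cancel t at a coordinate where x and y differ.
  difference-scale-injective : ∀ {N k} (x y : Vec (Fin N) k) → ¬ x ≡ y →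
    ∀ t t′ → V.map (t ℤ.*_) (difference x y) ≡ V.map (t′ ℤ.*_) (difference x y) → t ≡ t′
  difference-scale-injective [] [] x≢y t t′ eq = ⊥-elim (x≢y refl)
  difference-scale-injective (i ∷ x) (j ∷ y) x≢y t t′ eq with i Fin.≟ j
  ... | yes refl = difference-scale-injective x y (x≢y ∘ cong (i ∷_)) t t′ (VecP.∷-injectiveʳ eq)
  ... | no i≢j = ℤP.*-cancelʳ-≡ t t′ (+ toℕ j ℤ.- + toℕ i) {{ℤ.≢-nonZero j-i≢0}} (VecP.∷-injectiveˡ eq)
    where
    j-i≢0 : ¬ (+ toℕ j ℤ.- + toℕ i) ≡ + 0
    j-i≢0 e = i≢j (sym (FinP.toℕ-injective (ℤP.+-injective (ℤP.i-j≡0⇒i≡j _ _ e))))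

  difference-segment : ∀ {N k} t (x y : Vec (Fin N) k) →
    V.zipWith ℚ._+_ (V.map ((1ℚ ℚ.- t) ℚ.*_) (V.map ℤtoℚ (toℤᵛ x))) (V.map (t ℚ.*_) (V.map ℤtoℚ (toℤᵛ y)))
      ≡ V.zipWith ℚ._+_ (V.map (λ a → t ℚ.* ℤtoℚ a) (difference x y)) (V.map ℤtoℚ (toℤᵛ x))
  difference-segment t [] [] = refl
  difference-segment t (i ∷ x) (j ∷ y) = cong₂ _∷_ coordinate (difference-segment t x y)
    where
    open +-*-Solver
    X = ℤtoℚ (+ toℕ i)
    Y = ℤtoℚ (+ toℕ j)
    coordinate : (1ℚ ℚ.- t) ℚ.* X ℚ.+ t ℚ.* Y ≡ t ℚ.* ℤtoℚ (+ toℕ j ℤ.- + toℕ i) ℚ.+ X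
    coordinate = trans (solve 3 (λ t X Y → (con 1ℚ :- t) :* X :+ t :* Y := t :* (Y :+ (:- X)) :+ X) refl t X Y)
      (cong (λ e → t ℚ.* e ℚ.+ X) (sym (trans (ℤtoℚ-+ (+ toℕ j) (ℤ.- + toℕ i)) (cong (Y ℚ.+_) (ℤtoℚ-neg (+ toℕ i))))))

module ConvexHull (N : ℕ) .{{_ : NonZero N}} where

  import Data.Nat as ℕ
  open import Data.Rational using (_+_; _*_; _-_)
  import Data.Rational as ℚ
  import Data.Rational.Properties as ℚP
  open import Data.Vec as V using (Vec; []; _∷_; _++_)
  import Data.Vec.Properties as VecP
  open import Data.List as L using (List; []; _∷_)
  open import Data.List.Relation.Unary.All as All using ()
  import Data.List.Relation.Unary.All.Properties as AllP
  open import Data.Bool using (true)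
  open import Data.Product using (proj₂)
  open import Relation.Binary.PropositionalEquality
  open import Data.Rational.Solver using (module +-*-Solver)
  open +-*-Solver
  open BlockMatrices using (replicate-++)

  zipWith-map-map : ∀ {A B C D : Set} {n} {_⊕_ : B → C → D} {f : A → B} {g : A → C} {h : A → D} →
    (∀ a → f a ⊕ g a ≡ h a) → (u : Vec A n) → V.zipWith _⊕_ (V.map f u) (V.map g u) ≡ V.map h u
  zipWith-map-map eq [] = refl
  zipWith-map-map eq (a ∷ u) = cong₂ _∷_ (eq a) (zipWith-map-map eq u)

  scale-distrib : ∀ {n} (a w : ℚ) (u c : Vec ℚ n) →
    V.zipWith _+_ (V.map ((a * w) *_) u) (V.map (a *_) c) ≡ V.map (a *_) (V.zipWith _+_ (V.map (w *_) u) c)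
  scale-distrib a w [] [] = refl
  scale-distrib a w (v ∷ u) (e ∷ c) =
    cong₂ _∷_ (solve 4 (λ a w v e → (a :* w) :* v :+ a :* e := a :* (w :* v :+ e)) refl a w v e) (scale-distrib a w u c)

  prefix : ∀ {j r} → ℚ → Point N j → ℚ × Point N r → ℚ × Point N (j ℕ.+ r)
  prefix a v (w , p) = a * w , v ++ p

  module _ {j : ℕ} where

    sumWeights-++ : (ws vs : List (ℚ × Point N j)) → sumWeights N (ws L.++ vs) ≡ sumWeights N ws + sumWeights N vs
    sumWeights-++ [] vs = sym (ℚP.+-identityˡ _)
    sumWeights-++ ((w , p) ∷ ws) vs = trans (cong (w +_) (sumWeights-++ ws vs)) (sym (ℚP.+-assoc w _ _))

    combo-++ : (ws vs : List (ℚ × Point N j)) → combo N (ws L.++ vs) ≡ V.zipWith _+_ (combo N ws) (combo N vs)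
    combo-++ [] vs = sym (VecP.zipWith-identityˡ ℚP.+-identityˡ (combo N vs))
    combo-++ ((w , p) ∷ ws) vs = trans (cong (V.zipWith _+_ _) (combo-++ ws vs)) (sym (VecP.zipWith-assoc ℚP.+-assoc _ _ _))

    module _ {r : ℕ} (a : ℚ) (v : Point N j) where

      sumWeights-prefix : (ws : List (ℚ × Point N r)) → sumWeights N (L.map (prefix a v) ws) ≡ a * sumWeights N ws
      sumWeights-prefix [] = sym (ℚP.*-zeroʳ a)
      sumWeights-prefix ((w , p) ∷ ws) = trans (cong (a * w +_) (sumWeights-prefix ws)) (sym (ℚP.*-distribˡ-+ a w _))

      combo-prefix : (ws : List (ℚ × Point N r)) → combo N (L.map (prefix a v) ws)
        ≡ V.map ((a * sumWeights N ws) *_) (pointℚ N v) ++ V.map (a *_) (combo N ws)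
      combo-prefix [] = trans (replicate-++ 0ℚ j r) (cong₂ _++_
        (sym (trans (VecP.map-cong (λ e → trans (cong (_* e) (ℚP.*-zeroʳ a)) (ℚP.*-zeroˡ e)) (pointℚ N v))
                    (VecP.map-const (pointℚ N v) 0ℚ)))
        (sym (trans (VecP.map-replicate (a *_) 0ℚ r) (cong (V.replicate r) (ℚP.*-zeroʳ a)))))
      combo-prefix ((w , p) ∷ ws) = begin
        V.zipWith _+_ (V.map ((a * w) *_) (pointℚ N (v ++ p))) (combo N (L.map (prefix a v) ws))
          ≡⟨ cong₂ (V.zipWith _+_)
               (trans (cong (V.map ((a * w) *_)) (VecP.map-++ _ v p)) (VecP.map-++ ((a * w) *_) (pointℚ N v) (pointℚ N p)))
                                   (combo-prefix ws) ⟩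
        V.zipWith _+_ (V.map ((a * w) *_) (pointℚ N v) ++ V.map ((a * w) *_) (pointℚ N p))
                      (V.map ((a * W) *_) (pointℚ N v) ++ V.map (a *_) (combo N ws))
          ≡⟨ VecP.zipWith-++ _+_ (V.map ((a * w) *_) (pointℚ N v)) _ _ _ ⟩
        V.zipWith _+_ (V.map ((a * w) *_) (pointℚ N v)) (V.map ((a * W) *_) (pointℚ N v)) ++
        V.zipWith _+_ (V.map ((a * w) *_) (pointℚ N p)) (V.map (a *_) (combo N ws))
          ≡⟨ cong₂ _++_
               (zipWith-map-map (λ e → solve 4 (λ a w W e → (a :* w) :* e :+ (a :* W) :* e := (a :* (w :+ W)) :* e) refl a w W e)
                                (pointℚ N v))
                        (scale-distrib a w (pointℚ N p) (combo N ws)) ⟩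
        V.map ((a * (w + W)) *_) (pointℚ N v) ++ V.map (a *_) (V.zipWith _+_ (V.map (w *_) (pointℚ N p)) (combo N ws)) ∎
        where
        open ≡-Reasoning
        W = sumWeights N ws

  segment : ∀ {j} → ℚ → Point N j → Point N j → Vec ℚ j
  segment t x y = V.zipWith _+_ (V.map ((1ℚ - t) *_) (pointℚ N x)) (V.map (t *_) (pointℚ N y))

  InConv-segment× : ∀ {j r} {S : GridSubset N (j ℕ.+ r)} {T : GridSubset N r} (x y : Point N j) →
    (∀ z → T z ≡ true → S (x ++ z) ≡ true) → (∀ z → T z ≡ true → S (y ++ z) ≡ true) →
    ∀ {t w} → 0ℚ ≤ℚ t → t ≤ℚ 1ℚ → InConv N T w → InConv N S (segment t x y ++ w)
  InConv-segment× {j} {r} {S} x y T⊆Sx T⊆Sy {t} {w} 0≤t t≤1 (ws , ws⊆T , ws≥0 , Σws≡1 , combo≡w) =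
    ws′ , ws′⊆S , ws′≥0 , Σws′≡1 , combo≡
    where
    ws′ : List (ℚ × Point N (j ℕ.+ r))
    ws′ = L.map (prefix (1ℚ - t) x) ws L.++ L.map (prefix t y) ws
    ws′⊆S : All.All (λ wp → S (proj₂ wp) ≡ true) ws′
    ws′⊆S = AllP.++⁺ (AllP.map⁺ (All.map (T⊆Sx _) ws⊆T)) (AllP.map⁺ (All.map (T⊆Sy _) ws⊆T))
    0≤1-t : 0ℚ ≤ℚ 1ℚ - t
    0≤1-t = subst (_≤ℚ 1ℚ - t) (ℚP.+-inverseʳ t) (ℚP.+-monoˡ-≤ (ℚ.- t) t≤1)
    0≤* : ∀ {a b} → 0ℚ ≤ℚ a → 0ℚ ≤ℚ b → 0ℚ ≤ℚ a * b
    0≤* {a} {b} 0≤a 0≤b = ℚP.nonNegative⁻¹ (a * b) {{ℚP.nonNeg*nonNeg⇒nonNeg a {{ℚ.nonNegative 0≤a}} b {{ℚ.nonNegative 0≤b}}}}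
    ws′≥0 : All.All (λ wp → 0ℚ ≤ℚ proj₁ wp) ws′
    ws′≥0 = AllP.++⁺ (AllP.map⁺ (All.map (0≤* 0≤1-t) ws≥0)) (AllP.map⁺ (All.map (0≤* 0≤t) ws≥0))
    Σws′≡1 : sumWeights N ws′ ≡ 1ℚ
    Σws′≡1 = begin
      sumWeights N ws′
        ≡⟨ sumWeights-++ (L.map (prefix (1ℚ - t) x) ws) (L.map (prefix t y) ws) ⟩
      sumWeights N (L.map (prefix (1ℚ - t) x) ws) + sumWeights N (L.map (prefix t y) ws)
        ≡⟨ cong₂ _+_ (sumWeights-prefix (1ℚ - t) x ws) (sumWeights-prefix t y ws) ⟩
      (1ℚ - t) * sumWeights N ws + t * sumWeights N ws
        ≡⟨ cong (λ W → (1ℚ - t) * W + t * W) Σws≡1 ⟩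
      (1ℚ - t) * 1ℚ + t * 1ℚ
        ≡⟨ solve 1 (λ t → (con 1ℚ :- t) :* con 1ℚ :+ t :* con 1ℚ := con 1ℚ) refl t ⟩
      1ℚ ∎
      where open ≡-Reasoning
    combo≡ : combo N ws′ ≡ segment t x y ++ w
    combo≡ = begin
      combo N ws′
        ≡⟨ combo-++ (L.map (prefix (1ℚ - t) x) ws) (L.map (prefix t y) ws) ⟩
      V.zipWith _+_ (combo N (L.map (prefix (1ℚ - t) x) ws)) (combo N (L.map (prefix t y) ws))
        ≡⟨ cong₂ (V.zipWith _+_) (combo-prefix (1ℚ - t) x ws) (combo-prefix t y ws) ⟩
      V.zipWith _+_ (V.map (((1ℚ - t) * W) *_) (pointℚ N x) ++ V.map ((1ℚ - t) *_) (combo N ws))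
                    (V.map ((t * W) *_) (pointℚ N y) ++ V.map (t *_) (combo N ws))
        ≡⟨ VecP.zipWith-++ _+_ (V.map (((1ℚ - t) * W) *_) (pointℚ N x)) _ _ _ ⟩
      V.zipWith _+_ (V.map (((1ℚ - t) * W) *_) (pointℚ N x)) (V.map ((t * W) *_) (pointℚ N y)) ++
      V.zipWith _+_ (V.map ((1ℚ - t) *_) (combo N ws)) (V.map (t *_) (combo N ws))
        ≡⟨ cong₂ _++_
             (cong (λ W → V.zipWith _+_ (V.map (((1ℚ - t) * W) *_) (pointℚ N x)) (V.map ((t * W) *_) (pointℚ N y))) Σws≡1)
             (zipWith-map-map (λ e → solve 2 (λ t e → (con 1ℚ :- t) :* e :+ t :* e := e) refl t e) (combo N ws)) ⟩
      V.zipWith _+_ (V.map (((1ℚ - t) * 1ℚ) *_) (pointℚ N x)) (V.map ((t * 1ℚ) *_) (pointℚ N y)) ++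
      V.map (λ e → e) (combo N ws)
        ≡⟨ cong₂ _++_
             (cong₂ (λ a b → V.zipWith _+_ (V.map (a *_) (pointℚ N x)) (V.map (b *_) (pointℚ N y)))
                    (ℚP.*-identityʳ (1ℚ - t)) (ℚP.*-identityʳ t))
             (trans (VecP.map-id (combo N ws)) combo≡w) ⟩
      segment t x y ++ w ∎
      where
      open ≡-Reasoning
      W = sumWeights N ws

module CubeLifting (N : ℕ) .{{_ : NonZero N}} where

  import Data.Nat as ℕ
  open import Data.Integer using (+_)
  open import Data.Rational using (_+_; _*_)
  import Data.Rational.Properties as ℚP
  open import Data.Fin using (toℕ)
  open import Data.Vec as V using (Vec; []; _∷_; _++_)
  import Data.Vec.Properties as VecP
  open import Data.Vec.Relation.Unary.All using (All; _∷_)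
  open import Data.List.Relation.Unary.All using ([]; _∷_)
  open import Data.List using ([_])
  open import Data.Bool using (true; false; _∧_)
  open import Relation.Nullary using (¬_)
  open import Relation.Binary.PropositionalEquality hiding ([_])
  open BlockMatrices
  open ConvexHull N
  open Fibres N

  hasCube-point : ∀ {r} {T : GridSubset N r} (z : Point N r) → T z ≡ true → HasCube N T 0
  hasCube-point z Tz = [] , toℤᵛ z , (λ { [] [] _ → refl }) , λ { [] _ →
    [ (1ℚ , z) ] , (Tz ∷ []) , (ℚP.nonNegative⁻¹ 1ℚ ∷ []) , ℚP.+-identityʳ 1ℚ , corner }
    where
    corner : combo N [ (1ℚ , z) ] ≡ V.zipWith _+_ (zeroℚv _) (V.map ℤtoℚ (toℤᵛ z))
    corner = begin
      V.zipWith _+_ (V.map (1ℚ *_) (pointℚ N z)) (zeroℚv _)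
        ≡⟨ VecP.zipWith-identityʳ ℚP.+-identityʳ _ ⟩
      V.map (1ℚ *_) (pointℚ N z)
        ≡⟨ trans (VecP.map-cong ℚP.*-identityˡ (pointℚ N z)) (VecP.map-id _) ⟩
      pointℚ N z
        ≡⟨ VecP.map-∘ ℤtoℚ (λ i → + toℕ i) z ⟩
      V.map ℤtoℚ (toℤᵛ z)
        ≡⟨ VecP.zipWith-identityˡ ℚP.+-identityˡ _ ⟨
      V.zipWith _+_ (zeroℚv _) (V.map ℤtoℚ (toℤᵛ z)) ∎
      where open ≡-Reasoning

  hasCube-lift : ∀ {k r m} (S : GridSubset N (k ℕ.+ r)) (x y : Point N k) → ¬ x ≡ y →
    HasCube N (fibre S x ∩ fibre S y) m → HasCube N S (suc m)
  hasCube-lift {m = m} S x y x≢y (B , z , B-injective , cube) =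
    blockMat d B , toℤᵛ x ++ z , blockMat-injective d B (difference-scale-injective x y x≢y) B-injective , lifted
    where
    d = difference x y
    lifted : (v : Vec ℚ (suc m)) → All (λ t → (0ℚ ≤ℚ t) × (t ≤ℚ 1ℚ)) v →
      InConv N S (V.zipWith _+_ (applyℚ (blockMat d B) v) (V.map ℤtoℚ (toℤᵛ x ++ z)))
    lifted (t ∷ u) ((0≤t , t≤1) ∷ u∈cube) = subst (InConv N S) (sym corner)
      (InConv-segment× x y (λ z → ∧-elimˡ) (λ z → ∧-elimʳ (S (x ++ z))) 0≤t t≤1 (cube u u∈cube))
      where
      ∧-elimˡ : ∀ {a b} → a ∧ b ≡ true → a ≡ true
      ∧-elimˡ {true} _ = refl
      ∧-elimʳ : ∀ a {b} → a ∧ b ≡ true → b ≡ true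
      ∧-elimʳ true b≡true = b≡true
      ∧-elimʳ false ()
      corner : V.zipWith _+_ (applyℚ (blockMat d B) (t ∷ u)) (V.map ℤtoℚ (toℤᵛ x ++ z))
             ≡ segment t x y ++ V.zipWith _+_ (applyℚ B u) (V.map ℤtoℚ z)
      corner = begin
        V.zipWith _+_ (applyℚ (blockMat d B) (t ∷ u)) (V.map ℤtoℚ (toℤᵛ x ++ z))
          ≡⟨ cong₂ (V.zipWith _+_) (applyℚ-blockMat d B t u) (VecP.map-++ ℤtoℚ (toℤᵛ x) z) ⟩
        V.zipWith _+_ (V.map (λ a → t * ℤtoℚ a) d ++ applyℚ B u) (V.map ℤtoℚ (toℤᵛ x) ++ V.map ℤtoℚ z)
          ≡⟨ VecP.zipWith-++ _+_ (V.map (λ a → t * ℤtoℚ a) d) (applyℚ B u) _ _ ⟩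
        V.zipWith _+_ (V.map (λ a → t * ℤtoℚ a) d) (V.map ℤtoℚ (toℤᵛ x)) ++ V.zipWith _+_ (applyℚ B u) (V.map ℤtoℚ z)
          ≡⟨ cong (_++ _) (trans (sym (difference-segment t x y))
               (cong₂ (λ px py → V.zipWith _+_ (V.map _ px) (V.map _ py))
                      (sym (VecP.map-∘ ℤtoℚ _ x)) (sym (VecP.map-∘ ℤtoℚ _ y)))) ⟩
        segment t x y ++ V.zipWith _+_ (applyℚ B u) (V.map ℤtoℚ z) ∎
        where open ≡-Reasoning

module Classical where

  open import Data.Nat using (zero; s≤s⁻¹)
  open import Data.Nat.Properties using (≤∧≢⇒<)
  open import Relation.Nullary using (¬_; yes; no)
  open import Relation.Nullary.Decidable using (¬¬-excluded-middle)
  open import Relation.Binary.PropositionalEquality using (refl)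

  ¬¬-greatest : (P : ℕ → Set) → P 0 → ∀ {j} → (∀ m → P m → m ≤ j) → ¬ ¬ (Σ ℕ λ n → P n × (∀ m → P m → m ≤ n))
  ¬¬-greatest P p0 {j} bounded ¬greatest = below j λ (n , pn , greatest) → ¬greatest (n , pn , λ m pm → greatest m pm (bounded m pm))
    where
    below : ∀ j → ¬ ¬ (Σ ℕ λ n → P n × (∀ m → P m → m ≤ j → m ≤ n))
    below zero ¬max = ¬max (0 , p0 , λ _ _ m≤0 → m≤0)
    below (suc j) ¬max = below j λ (n , pn , greatest) → ¬¬-excluded-middle {A = P (suc j)} λ
      { (yes p[1+j]) → ¬max (suc j , p[1+j] , λ _ _ m≤1+j → m≤1+j)
      ; (no ¬p[1+j]) → ¬max (n , pn , λ m pm m≤1+j →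
          greatest m pm (s≤s⁻¹ (≤∧≢⇒< m≤1+j λ { refl → ¬p[1+j] pm }))) }

module DensityIncrement (N : ℕ) .{{_ : NonZero N}} where

  open import Data.Nat as ℕ using (_+_; _*_; _^_; _≤?_; s≤s)
  import Data.Nat.Properties as ℕP
  open import Data.Integer using (+_)
  import Data.Rational as ℚ
  import Data.Rational.Properties as ℚP
  open import Relation.Nullary using (¬_)
  open import Relation.Nullary.Decidable using (decidable-stable)
  open import Relation.Binary.PropositionalEquality
  open import Data.Bool using (true)
  open FiniteSums
  open RationalEmbedding
  open DensityBounds
  open Fibres N
  open Classical
  open CubeLifting N

  0<cPrime : ∀ c (0<c : 0ℚ <ℚ c) → 0ℚ <ℚ cPrime c 0<c
  0<cPrime c 0<c =
    ℚP.positive⁻¹ _ {{ℚP.pos*pos⇒pos (ℕtoℚ 2 ℚ.* (c ℚ.* c)) {{2c²>0}} _ {{ℚP.1/pos⇒pos (d ℚ.* d) {{d²>0}}}}}}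
    where
    d = c ℚ.+ ℕtoℚ 4
    instance
      _ : ℚ.Positive c
      _ = ℚ.positive 0<c
    2c²>0 : ℚ.Positive (ℕtoℚ 2 ℚ.* (c ℚ.* c))
    2c²>0 = ℚP.pos*pos⇒pos (ℕtoℚ 2) {{ℕtoℚ-pos 2}} (c ℚ.* c) {{ℚP.pos*pos⇒pos c c}}
    d>0 : ℚ.Positive d
    d>0 = ℚP.pos+pos⇒pos c (ℕtoℚ 4) {{ℕtoℚ-pos 4}}
    d²>0 : ℚ.Positive (d ℚ.* d)
    d²>0 = ℚP.pos*pos⇒pos d {{d>0}} d {{d>0}}

  positive-density⇒nonempty : ∀ {n} (T : GridSubset N n) → 0ℚ <ℚ δ N T → Σ (Point N n) λ z → T z ≡ true
  positive-density⇒nonempty {n} T 0<δT = 0<sumOver-𝟙⇒∃ (allPoints N n) T (ℕP.n≢0⇒n>0 λ card≡0 →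
    ℚP.<-irrefl (sym (trans (cong (λ s → ((+ s) ℚ./ N ^ n) {{ℕP.m^n≢0 N n}}) card≡0) (ℚP.0/n≡0 (N ^ n) {{ℕP.m^n≢0 N n}})))
      0<δT)

  ∃-dense-fibre-pair : ∀ {c} (0<c : 0ℚ <ℚ c) k r (S : GridSubset N (k + r)) → c ≤ℚ δ N S →
    eightOverSq c 0<c ≤ℚ ℕtoℚ (N ^ k) →
    Σ (Point N k) λ x → Σ (Point N k) λ y → ¬ x ≡ y × cPrime c 0<c ≤ℚ δ N (fibre S x ∩ fibre S y)
  ∃-dense-fibre-pair {c} 0<c k r S c≤δS 8/c²≤N^k = fromRatio (positive-ratio c 0<c)
    where
    open FibreCounting k r S
    fromRatio : (Σ ℕ λ p → Σ ℕ λ q-1 → c ℚ.* ℕtoℚ (suc q-1) ≡ ℕtoℚ p) →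
      Σ (Point N k) λ x → Σ (Point N k) λ y → ¬ x ≡ y × cPrime c 0<c ≤ℚ δ N (fibre S x ∩ fibre S y)
    fromRatio (p , q-1 , c*q≡p) = dense (∃-largeOverlap p q (8/c²≤K⇒8q²≤Kp² c 0<c p q c*q≡p K 8/c²≤N^k) pKm≤qs)
      where
      q = suc q-1
      pKm≤qs : p * K * m ℕ.≤ q * card N S
      pKm≤qs = subst₂ ℕ._≤_ (trans (cong (p *_) (ℕP.^-distribˡ-+-* N k r)) (sym (ℕP.*-assoc p K m))) (ℕP.*-comm (card N S) q)
        (c≤s/d⇒pd≤sq c 0<c p q c*q≡p (card N S) (N ^ (k + r)) {{ℕP.m^n≢0 N (k + r)}} c≤δS)
      dense : (Σ (Point N k) λ x → Σ (Point N k) λ y → LargeOverlap (2 * (p * p) * m) ((p + 4 * q) * (p + 4 * q)) x y) →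
        Σ (Point N k) λ x → Σ (Point N k) λ y → ¬ x ≡ y × cPrime c 0<c ≤ℚ δ N (fibre S x ∩ fibre S y)
      dense (x , y , x≢y , large) = x , y , x≢y , 2p²m≤Ei⇒c′≤i/m c 0<c p q c*q≡p (fibreOverlap x y) m {{ℕP.m^n≢0 N r}} large

  ¬¬-M[Sx∩Sy]<M[S] : ∀ {k r a} (S : GridSubset N (k + r)) (x y : Point N k) → ¬ x ≡ y →
    (z : Point N r) → (fibre S x ∩ fibre S y) z ≡ true → IsM N S a →
    ¬ ¬ (Σ ℕ λ m → IsM N (fibre S x ∩ fibre S y) m × suc m ≤ a)
  ¬¬-M[Sx∩Sy]<M[S] S x y x≢y z Tz (_ , M[S]-maximal) ¬gap =
    ¬¬-greatest (HasCube N _) (hasCube-point z Tz) (λ m cube → ℕP.<⇒≤ (lift cube)) λ (m , cube , maximal) →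
      ¬gap (m , (cube , maximal) , lift cube)
    where
    lift : ∀ {m} → HasCube N (fibre S x ∩ fibre S y) m → suc m ≤ _
    lift {m} cube = M[S]-maximal (suc m) (hasCube-lift S x y x≢y cube)

  M>f : ∀ {c} (0<c : 0ℚ <ℚ c) k r (S : GridSubset N (k + r)) {a b} → c ≤ℚ δ N S →
    eightOverSq c 0<c ≤ℚ ℕtoℚ (N ^ k) → IsM N S a → IsF N r (cPrime c 0<c) b → suc b ≤ a
  M>f {c} 0<c k r S {a} {b} c≤δS 8/c²≤N^k M[S]≡a (_ , f-minimal) =
    fromPair (∃-dense-fibre-pair 0<c k r S c≤δS 8/c²≤N^k)
    where
    fromPair : (Σ (Point N k) λ x → Σ (Point N k) λ y → ¬ x ≡ y × cPrime c 0<c ≤ℚ δ N (fibre S x ∩ fibre S y)) → suc b ≤ a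
    fromPair (x , y , x≢y , c′≤δT) = fromPoint (positive-density⇒nonempty T (ℚP.<-≤-trans (0<cPrime c 0<c) c′≤δT))
      where
      T = fibre S x ∩ fibre S y
      fromPoint : (Σ (Point N r) λ z → T z ≡ true) → suc b ≤ a
      fromPoint (z , Tz) = decidable-stable (suc b ≤? a) λ b≮a → ¬¬-M[Sx∩Sy]<M[S] S x y x≢y z Tz M[S]≡a λ (m , M[T]≡m , m<a) →
        b≮a (ℕP.≤-trans (s≤s (f-minimal T c′≤δT m M[T]≡m)) m<a)

proposition2p4 :
    (N : ℕ) .{{_ : NonZero N}} → 2 ≤ N →
    (c : ℚ) (0<c : 0ℚ <ℚ c) → c ≤ℚ 1ℚ →
    (k : ℕ) → IsCeilLog N (eightOverSq c 0<c) k →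
    (n : ℕ) → k < n →
    (a b : ℕ) → IsF N n c a → IsF N (n ∸ k) (cPrime c 0<c) b →
    suc b ≤ a
proposition2p4 N _ c 0<c _ k (8/c²≤N^k , _) n k<n a b isF-a isF-b =
  fromDenseSet (proj₁ (subst (λ j → IsF N j c a) (sym (m+[n∸m]≡n (<⇒≤ k<n))) isF-a))
  where
  fromDenseSet : (Σ (GridSubset N (k Data.Nat.+ (n ∸ k))) λ S → (c ≤ℚ δ N S) × IsM N S a) → suc b ≤ a
  fromDenseSet (S , c≤δS , M[S]≡a) = DensityIncrement.M>f N 0<c k (n ∸ k) S c≤δS 8/c²≤N^k M[S]≡a isF-b
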